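{- Let $\mathcal T\in\{\mathcal T_{\rm CD},\mathcal T_{\rm CDS},\mathcal T_{\rm CDV},\mathcal T_{\rm BCD}\}$. (1) If $B\vdash^{\mathcal T}_{\equiv}\Delta_1:\sigma$ and $\Delta_1\to^{\parallel}\Delta_2$, then $B\vdash^{\mathcal T}_{\equiv}\Delta_2:\sigma$. (2) For $\mathcal R\in\{=_\beta,=_{\beta\eta}\}$, if $B\vdash^{\mathcal T}_{\mathcal R}\Delta_1:\sigma$ and $\Delta_1\to\Delta_2$, then $B\vdash^{\mathcal T}_{\mathcal R}\Delta_2:\sigma$.
   Context: Types: $\mathbb A_\infty=\{a_i\mid i\in\mathbb N\}$, $\omega$ special atom, $\mathbb A^\omega_\infty=\mathbb A_\infty\cup\{\omega\}$; types $\sigma::=\mathbb A\mid\sigma\to\sigma\mid\sigma\cap\sigma$. Minimal type theory: (refl), (incl) $\sigma\cap\tau\le\sigma,\sigma\cap\tau\le\tau$, (glb) $\rho\le\sigma,\rho\le\tau\Rightarrow\rho\le\sigma\cap\tau$, (trans). Extras: $(\omega_{top})$ $\sigma\le\omega$; $(\omega_\to)$ $\omega\le\sigma\to\omega$; $(\to\cap)$ $(\sigma\to\tau)\cap(\sigma\to\rho)\le\sigma\to\tau\cap\rho$; $(\to)$ $\sigma_2\le\sigma_1,\tau_1\le\tau_2\Rightarrow\sigma_1\to\tau_1\le\sigma_2\to\tau_2$. $\mathcal T_{\rm CD}$: over $\mathbb A_\infty$, minimal; $\mathcal T_{\rm CDS}$: over $\mathbb A^\omega_\infty$, plus $(\omega_{top})$;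 $\mathcal T_{\rm CDV}$: over $\mathbb A_\infty$, plus $(\to),(\to\cap)$; $\mathcal T_{\rm BCD}$: over $\mathbb A^\omega_\infty$, plus all four extras. $\Delta$-terms: $\Delta::=u_\Delta\mid x\mid\lambda x{:}\sigma.\Delta\mid\Delta\,\Delta\mid\langle\Delta,\Delta\rangle\mid pr_i\Delta\mid\Delta^\sigma$, $u_\Delta$ a constant indexed by an arbitrary $\Delta$-term. Essence: $\lfloor x\rfloor=x$, $\lfloor u_\Delta\rfloor=\lfloor\Delta\rfloor$, $\lfloor\Delta^\sigma\rfloor=\lfloor\Delta\rfloor$, $\lfloor\lambda x{:}\sigma.\Delta\rfloor=\lambda x.\lfloor\Delta\rfloor$, $\lfloor\Delta_1\Delta_2\rfloor=\lfloor\Delta_1\rfloor\lfloor\Delta_2\rfloor$, $\lfloor\langle\Delta_1,\Delta_2\rangle\rfloor=\lfloor\Delta_1\rfloor$, $\lfloor pr_i\Delta\rfloor=\lfloor\Delta\rfloor$. Typed system $\Delta^{\mathcal T}_{\mathcal R}$, $\mathcal R\in\{\equiv,=_\beta,=_{\beta\eta}\}$ an equivalence on pure $\lambda$-terms: (top) $B\vdash u_\Delta:\omega$ if $\omega$ is an atom of $\mathcal T$; (ax) $B\vdash x:\sigma$ if $x{:}\sigma\in B$; ($\to I$) $B,x{:}\sigma\vdash\Delta:\tau\Rightarrow B\vdash\lambda x{:}\sigma.\Delta:\sigma\to\tau$; ($\to E$) from $\Delta_1:\sigma\to\tau$, $\Delta_2:\sigma$ get $\Delta_1\Delta_2:\tau$;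 ($\cap I$) from $B\vdash\Delta_1:\sigma$, $B\vdash\Delta_2:\tau$, $\lfloor\Delta_1\rfloor\mathcal R\lfloor\Delta_2\rfloor$ get $B\vdash\langle\Delta_1,\Delta_2\rangle:\sigma\cap\tau$; ($\cap E_i$) from $\Delta:\sigma\cap\tau$ get $pr_1\Delta:\sigma$, $pr_2\Delta:\tau$; ($\le_{\mathcal T}$) from $\Delta:\sigma$ and $\sigma\le_{\mathcal T}\tau$ get $\Delta^\tau:\tau$. Reduction: substitution is capture-avoiding with $u_{\Delta_1}[\Delta_2/x]=u_{(\Delta_1[\Delta_2/x])}$, $\Delta_1^\sigma[\Delta_2/x]=(\Delta_1[\Delta_2/x])^\sigma$. Redexes: $(\beta)$ $(\lambda x{:}\sigma.\Delta_1)\Delta_2\to\Delta_1[\Delta_2/x]$; $(pr_i)$ $pr_i\langle\Delta_1,\Delta_2\rangle\to\Delta_i$ (a coerced abstraction applied to an argument is not a redex). $\to$ is the usual contextual closure of $(\beta),(pr_i)$, except that no reduction takes place inside the index of $u_\Delta$. $\to^\parallel$ (synchronous closure) is defined as the contextual closure of $(\beta),(pr_i)$ with the same restriction, except that the only closure rule under strong pairs is: $\langle\Delta_1,\Delta_2\rangle\to^\parallel\langle\Delta_1',\Delta_2'\rangle$ whenever $\Delta_1\to^\parallel\Delta_1'$, $\Delta_2\to^\parallel\Delta_2'$ and $\lfloor\Delta_1'\rfloor\equiv\lfloor\Delta_2'\rfloor$. -}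

module Defs where

open import Data.Bool using (Bool; true; false; T)
open import Data.Unit using (tt)
open import Data.Nat using (ℕ; zero; suc)
open import Data.Fin using (Fin; zero; suc)
open import Data.Vec using (Vec; _∷_; lookup)
open import Relation.Binary.PropositionalEquality using (_≡_)
open import Relation.Binary.Construct.Closure.Equivalence using (EqClosure)

data Theory : Set where
  CD CDS CDV BCD : Theory

hasω : Theory → Bool
hasω CD  = false
hasω CDS = true
hasω CDV = false
hasω BCD = true

hasArrowRules : Theory → Bool
hasArrowRules CD  = false
hasArrowRules CDS = false
hasArrowRules CDV = true
hasArrowRules BCD = true

-- Types over A_∞ (b = false) or A_∞ ∪ {ω} (b = true)

infixr 7 _⇒_
infixl 8 _∩_

data Type (b : Bool) : Set where
  atom : ℕ → Type b
  ω    : T b → Type b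
  _⇒_  : Type b → Type b → Type b
  _∩_  : Type b → Type b → Type b

Ty : Theory → Set
Ty 𝒯 = Type (hasω 𝒯)

infix 4 _⊢_≤_
data _⊢_≤_ : (𝒯 : Theory) → Ty 𝒯 → Ty 𝒯 → Set where
  refl  : ∀ {𝒯 σ} → 𝒯 ⊢ σ ≤ σ
  incl₁ : ∀ {𝒯 σ τ} → 𝒯 ⊢ σ ∩ τ ≤ σ
  incl₂ : ∀ {𝒯 σ τ} → 𝒯 ⊢ σ ∩ τ ≤ τ
  glb   : ∀ {𝒯 ρ σ τ} → 𝒯 ⊢ ρ ≤ σ → 𝒯 ⊢ ρ ≤ τ → 𝒯 ⊢ ρ ≤ σ ∩ τ
  trans : ∀ {𝒯 ρ σ τ} → 𝒯 ⊢ ρ ≤ σ → 𝒯 ⊢ σ ≤ τ → 𝒯 ⊢ ρ ≤ τ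
  ω-top : ∀ {𝒯 σ} (p : T (hasω 𝒯)) → 𝒯 ⊢ σ ≤ ω p
  ω-⇒   : ∀ {σ} → BCD ⊢ ω tt ≤ σ ⇒ ω tt
  ⇒-∩   : ∀ {𝒯 σ τ ρ} → T (hasArrowRules 𝒯) →
          𝒯 ⊢ (σ ⇒ τ) ∩ (σ ⇒ ρ) ≤ σ ⇒ (τ ∩ ρ)
  ⇒-mono : ∀ {𝒯 σ₁ σ₂ τ₁ τ₂} → T (hasArrowRules 𝒯) →
           𝒯 ⊢ σ₂ ≤ σ₁ → 𝒯 ⊢ τ₁ ≤ τ₂ → 𝒯 ⊢ σ₁ ⇒ τ₁ ≤ σ₂ ⇒ τ₂

Ren : ℕ → ℕ → Set
Ren m n = Fin m → Fin n

ext : ∀ {m n} → Ren m n → Ren (suc m) (suc n)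
ext ρ zero    = zero
ext ρ (suc i) = suc (ρ i)

data Λ (n : ℕ) : Set where
  var : Fin n → Λ n
  lam : Λ (suc n) → Λ n
  app : Λ n → Λ n → Λ n

renΛ : ∀ {m n} → Ren m n → Λ m → Λ n
renΛ ρ (var i)   = var (ρ i)
renΛ ρ (lam M)   = lam (renΛ (ext ρ) M)
renΛ ρ (app M N) = app (renΛ ρ M) (renΛ ρ N)

extsΛ : ∀ {m n} → (Fin m → Λ n) → Fin (suc m) → Λ (suc n)
extsΛ s zero    = var zero
extsΛ s (suc i) = renΛ suc (s i)

subΛ : ∀ {m n} → (Fin m → Λ n) → Λ m → Λ n
subΛ s (var i)   = s i
subΛ s (lam M)   = lam (subΛ (extsΛ s) M)
subΛ s (app M N) = app (subΛ s M) (subΛ s N)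

_[_]Λ : ∀ {n} → Λ (suc n) → Λ n → Λ n
M [ N ]Λ = subΛ (λ { zero → N ; (suc i) → var i }) M

data Red (η? : Bool) : {n : ℕ} → Λ n → Λ n → Set where
  β    : ∀ {n} {M : Λ (suc n)} {N : Λ n} → Red η? (app (lam M) N) (M [ N ]Λ)
  η    : ∀ {n} {M : Λ n} → T η? → Red η? (lam (app (renΛ suc M) (var zero))) M
  ξlam  : ∀ {n} {M M' : Λ (suc n)} → Red η? M M' → Red η? (lam M) (lam M')
  ξappₗ : ∀ {n} {M M' N : Λ n} → Red η? M M' → Red η? (app M N) (app M' N)
  ξappᵣ : ∀ {n} {M N N' : Λ n} → Red η? N N' → Red η? (app M N) (app M N')

LRel : Set₁
LRel = ∀ {n} → Λ n → Λ n → Set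

_≡Λ_ : LRel
M ≡Λ N = M ≡ N

_=β_ : LRel
_=β_ {n} = EqClosure (Red false {n})

_=βη_ : LRel
_=βη_ {n} = EqClosure (Red true {n})

data BetaKind : Set where
  βK βηK : BetaKind

⟦_⟧ : BetaKind → LRel
⟦ βK ⟧  = _=β_
⟦ βηK ⟧ = _=βη_

data Tm (b : Bool) (n : ℕ) : Set where
  u    : Tm b n → Tm b n
  var  : Fin n → Tm b n
  lam  : Type b → Tm b (suc n) → Tm b n
  app  : Tm b n → Tm b n → Tm b n
  pair : Tm b n → Tm b n → Tm b n
  pr₁  : Tm b n → Tm b n
  pr₂  : Tm b n → Tm b n
  coe  : Tm b n → Type b → Tm b n

ren : ∀ {b m n} → Ren m n → Tm b m → Tm b n
ren ρ (u M)      = u (ren ρ M)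
ren ρ (var i)    = var (ρ i)
ren ρ (lam σ M)  = lam σ (ren (ext ρ) M)
ren ρ (app M N)  = app (ren ρ M) (ren ρ N)
ren ρ (pair M N) = pair (ren ρ M) (ren ρ N)
ren ρ (pr₁ M)    = pr₁ (ren ρ M)
ren ρ (pr₂ M)    = pr₂ (ren ρ M)
ren ρ (coe M σ)  = coe (ren ρ M) σ

exts : ∀ {b m n} → (Fin m → Tm b n) → Fin (suc m) → Tm b (suc n)
exts s zero    = var zero
exts s (suc i) = ren suc (s i)

sub : ∀ {b m n} → (Fin m → Tm b n) → Tm b m → Tm b n
sub s (u M)      = u (sub s M)
sub s (var i)    = s i
sub s (lam σ M)  = lam σ (sub (exts s) M)
sub s (app M N)  = app (sub s M) (sub s N)
sub s (pair M N) = pair (sub s M) (sub s N)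
sub s (pr₁ M)    = pr₁ (sub s M)
sub s (pr₂ M)    = pr₂ (sub s M)
sub s (coe M σ)  = coe (sub s M) σ

_[_] : ∀ {b n} → Tm b (suc n) → Tm b n → Tm b n
M [ N ] = sub (λ { zero → N ; (suc i) → var i }) M

⌊_⌋ : ∀ {b n} → Tm b n → Λ n
⌊ u M ⌋      = ⌊ M ⌋
⌊ var i ⌋    = var i
⌊ lam σ M ⌋  = lam ⌊ M ⌋
⌊ app M N ⌋  = app ⌊ M ⌋ ⌊ N ⌋
⌊ pair M N ⌋ = ⌊ M ⌋
⌊ pr₁ M ⌋    = ⌊ M ⌋
⌊ pr₂ M ⌋    = ⌊ M ⌋
⌊ coe M σ ⌋  = ⌊ M ⌋

-- Typing  𝒯 ⨾ R ⨾ B ⊢ Δ ∶ σ   (B ⊢^𝒯_R Δ : σ)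

Ctx : Theory → ℕ → Set
Ctx 𝒯 n = Vec (Ty 𝒯) n

data _⨾_⨾_⊢_∶_ (𝒯 : Theory) (R : LRel) :
       ∀ {n} → Ctx 𝒯 n → Tm (hasω 𝒯) n → Ty 𝒯 → Set where
  top : ∀ {n} {B : Ctx 𝒯 n} {M} (p : T (hasω 𝒯)) → 𝒯 ⨾ R ⨾ B ⊢ u M ∶ ω p
  ax  : ∀ {n} {B : Ctx 𝒯 n} {x : Fin n} → 𝒯 ⨾ R ⨾ B ⊢ var x ∶ lookup B x
  ⇒I  : ∀ {n} {B : Ctx 𝒯 n} {σ τ M} →
        𝒯 ⨾ R ⨾ (σ ∷ B) ⊢ M ∶ τ → 𝒯 ⨾ R ⨾ B ⊢ lam σ M ∶ σ ⇒ τ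
  ⇒E  : ∀ {n} {B : Ctx 𝒯 n} {σ τ M N} →
        𝒯 ⨾ R ⨾ B ⊢ M ∶ σ ⇒ τ → 𝒯 ⨾ R ⨾ B ⊢ N ∶ σ → 𝒯 ⨾ R ⨾ B ⊢ app M N ∶ τ
  ∩I  : ∀ {n} {B : Ctx 𝒯 n} {σ τ M N} →
        𝒯 ⨾ R ⨾ B ⊢ M ∶ σ → 𝒯 ⨾ R ⨾ B ⊢ N ∶ τ → R ⌊ M ⌋ ⌊ N ⌋ →
        𝒯 ⨾ R ⨾ B ⊢ pair M N ∶ σ ∩ τ
  ∩E₁ : ∀ {n} {B : Ctx 𝒯 n} {σ τ M} → 𝒯 ⨾ R ⨾ B ⊢ M ∶ σ ∩ τ → 𝒯 ⨾ R ⨾ B ⊢ pr₁ M ∶ σ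
  ∩E₂ : ∀ {n} {B : Ctx 𝒯 n} {σ τ M} → 𝒯 ⨾ R ⨾ B ⊢ M ∶ σ ∩ τ → 𝒯 ⨾ R ⨾ B ⊢ pr₂ M ∶ τ
  ≤T  : ∀ {n} {B : Ctx 𝒯 n} {σ τ M} →
        𝒯 ⨾ R ⨾ B ⊢ M ∶ σ → 𝒯 ⊢ σ ≤ τ → 𝒯 ⨾ R ⨾ B ⊢ coe M τ ∶ τ

-- One-step reduction → (no reduction inside the index of u)

infix 4 _⟶_ _⟶∥_
infix 3 _⨾_⨾_⊢_∶_

data _⟶_ {b : Bool} : ∀ {n} → Tm b n → Tm b n → Set where
  β     : ∀ {n σ} {M : Tm b (suc n)} {N} → app (lam σ M) N ⟶ M [ N ]
  π₁    : ∀ {n} {M N : Tm b n} → pr₁ (pair M N) ⟶ M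
  π₂    : ∀ {n} {M N : Tm b n} → pr₂ (pair M N) ⟶ N
  ξlam  : ∀ {n σ} {M M' : Tm b (suc n)} → M ⟶ M' → lam σ M ⟶ lam σ M'
  ξappₗ : ∀ {n} {M M' N : Tm b n} → M ⟶ M' → app M N ⟶ app M' N
  ξappᵣ : ∀ {n} {M N N' : Tm b n} → N ⟶ N' → app M N ⟶ app M N'
  ξpairₗ : ∀ {n} {M M' N : Tm b n} → M ⟶ M' → pair M N ⟶ pair M' N
  ξpairᵣ : ∀ {n} {M N N' : Tm b n} → N ⟶ N' → pair M N ⟶ pair M N'
  ξpr₁  : ∀ {n} {M M' : Tm b n} → M ⟶ M' → pr₁ M ⟶ pr₁ M'
  ξpr₂  : ∀ {n} {M M' : Tm b n} → M ⟶ M' → pr₂ M ⟶ pr₂ M'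
  ξcoe  : ∀ {n σ} {M M' : Tm b n} → M ⟶ M' → coe M σ ⟶ coe M' σ

data _⟶∥_ {b : Bool} : ∀ {n} → Tm b n → Tm b n → Set where
  β     : ∀ {n σ} {M : Tm b (suc n)} {N} → app (lam σ M) N ⟶∥ M [ N ]
  π₁    : ∀ {n} {M N : Tm b n} → pr₁ (pair M N) ⟶∥ M
  π₂    : ∀ {n} {M N : Tm b n} → pr₂ (pair M N) ⟶∥ N
  ξlam  : ∀ {n σ} {M M' : Tm b (suc n)} → M ⟶∥ M' → lam σ M ⟶∥ lam σ M'
  ξappₗ : ∀ {n} {M M' N : Tm b n} → M ⟶∥ M' → app M N ⟶∥ app M' N
  ξappᵣ : ∀ {n} {M N N' : Tm b n} → N ⟶∥ N' → app M N ⟶∥ app M N'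
  ξpair : ∀ {n} {M M' N N' : Tm b n} → M ⟶∥ M' → N ⟶∥ N' →
          ⌊ M' ⌋ ≡ ⌊ N' ⌋ → pair M N ⟶∥ pair M' N'
  ξpr₁  : ∀ {n} {M M' : Tm b n} → M ⟶∥ M' → pr₁ M ⟶∥ pr₁ M'
  ξpr₂  : ∀ {n} {M M' : Tm b n} → M ⟶∥ M' → pr₂ M ⟶∥ pr₂ M'
  ξcoe  : ∀ {n σ} {M M' : Tm b n} → M ⟶∥ M' → coe M σ ⟶∥ coe M' σ

-- Typing is stable under substitution, provided the relation R used in (∩I) is
-- closed under substitution, because the essence of a substitution instance is
-- the corresponding instance of the essence. Hence a β-redex can be contracted
-- inside a derivation, and a projection of a strong pair simply keeps the
-- derivation of the chosen component. What remains is the side condition of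
-- (∩I) after a reduction inside a strong pair. The synchronous closure carries
-- the equality of the new essences with it, which suffices for R = ≡. For an
-- ordinary one-step reduction the essence changes by a single conversion step
-- (using the side condition of the pair itself for pr₂), so it suffices for R
-- to be a λ-theory, such as =β and =βη.
module Submission where

open import Defs hiding (refl; trans)
open import Data.Product using (_×_; _,_)
open import Data.Bool using (false; true)
open import Data.Nat using (suc)
open import Data.Fin using (Fin; zero; suc)
open import Data.Vec using (_∷_; lookup)
open import Function using (_∘_)
open import Relation.Binary.Structures using (IsEquivalence)
open import Relation.Binary.PropositionalEquality
  using (_≡_; refl; sym; trans; cong; cong₂; subst; subst₂)
open import Relation.Binary.Construct.Closure.Equivalence as EqClosure using (EqClosure)

ext-cong : ∀ {m n} {ρ ρ' : Ren m n} → (∀ i → ρ i ≡ ρ' i) → ∀ i → ext ρ i ≡ ext ρ' i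
ext-cong h zero    = refl
ext-cong h (suc i) = cong suc (h i)

renΛ-cong : ∀ {m n} {ρ ρ' : Ren m n} → (∀ i → ρ i ≡ ρ' i) → ∀ M → renΛ ρ M ≡ renΛ ρ' M
renΛ-cong h (var i)   = cong var (h i)
renΛ-cong h (lam M)   = cong lam (renΛ-cong (ext-cong h) M)
renΛ-cong h (app M N) = cong₂ app (renΛ-cong h M) (renΛ-cong h N)

extsΛ-cong : ∀ {m n} {s s' : Fin m → Λ n} → (∀ i → s i ≡ s' i) → ∀ i → extsΛ s i ≡ extsΛ s' i
extsΛ-cong h zero    = refl
extsΛ-cong h (suc i) = cong (renΛ suc) (h i)

subΛ-cong : ∀ {m n} {s s' : Fin m → Λ n} → (∀ i → s i ≡ s' i) → ∀ M → subΛ s M ≡ subΛ s' M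
subΛ-cong h (var i)   = h i
subΛ-cong h (lam M)   = cong lam (subΛ-cong (extsΛ-cong h) M)
subΛ-cong h (app M N) = cong₂ app (subΛ-cong h M) (subΛ-cong h N)

renΛ-renΛ : ∀ {k m n} (ρ : Ren m n) (ρ' : Ren k m) M → renΛ ρ (renΛ ρ' M) ≡ renΛ (ρ ∘ ρ') M
renΛ-renΛ ρ ρ' (var i)   = refl
renΛ-renΛ ρ ρ' (lam M)   = cong lam (trans (renΛ-renΛ (ext ρ) (ext ρ') M)
  (renΛ-cong (λ { zero → refl ; (suc i) → refl }) M))
renΛ-renΛ ρ ρ' (app M N) = cong₂ app (renΛ-renΛ ρ ρ' M) (renΛ-renΛ ρ ρ' N)

subΛ-renΛ : ∀ {k m n} (s : Fin m → Λ n) (ρ : Ren k m) M → subΛ s (renΛ ρ M) ≡ subΛ (s ∘ ρ) M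
subΛ-renΛ s ρ (var i)   = refl
subΛ-renΛ s ρ (lam M)   = cong lam (trans (subΛ-renΛ (extsΛ s) (ext ρ) M)
  (subΛ-cong (λ { zero → refl ; (suc i) → refl }) M))
subΛ-renΛ s ρ (app M N) = cong₂ app (subΛ-renΛ s ρ M) (subΛ-renΛ s ρ N)

renΛ-subΛ : ∀ {k m n} (ρ : Ren m n) (s : Fin k → Λ m) M →
            renΛ ρ (subΛ s M) ≡ subΛ (renΛ ρ ∘ s) M
renΛ-subΛ ρ s (var i)   = refl
renΛ-subΛ ρ s (lam M)   = cong lam (trans (renΛ-subΛ (ext ρ) (extsΛ s) M)
  (subΛ-cong (λ { zero → refl
                ; (suc i) → trans (renΛ-renΛ (ext ρ) suc (s i)) (sym (renΛ-renΛ suc ρ (s i))) }) M))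
renΛ-subΛ ρ s (app M N) = cong₂ app (renΛ-subΛ ρ s M) (renΛ-subΛ ρ s N)

subΛ-weaken : ∀ {m n} (s : Fin m → Λ n) M → subΛ (extsΛ s) (renΛ suc M) ≡ renΛ suc (subΛ s M)
subΛ-weaken s M = trans (subΛ-renΛ (extsΛ s) suc M) (sym (renΛ-subΛ suc s M))

subΛ-subΛ : ∀ {k m n} (s : Fin m → Λ n) (t : Fin k → Λ m) M →
            subΛ s (subΛ t M) ≡ subΛ (subΛ s ∘ t) M
subΛ-subΛ s t (var i)   = refl
subΛ-subΛ s t (lam M)   = cong lam (trans (subΛ-subΛ (extsΛ s) (extsΛ t) M)
  (subΛ-cong (λ { zero → refl ; (suc i) → subΛ-weaken s (t i) }) M))
subΛ-subΛ s t (app M N) = cong₂ app (subΛ-subΛ s t M) (subΛ-subΛ s t N)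

subΛ-var : ∀ {n} {s : Fin n → Λ n} → (∀ i → s i ≡ var i) → ∀ M → subΛ s M ≡ M
subΛ-var h (var i)   = h i
subΛ-var h (lam M)   = cong lam (subΛ-var (λ { zero → refl ; (suc i) → cong (renΛ suc) (h i) }) M)
subΛ-var h (app M N) = cong₂ app (subΛ-var h M) (subΛ-var h N)

renΛ-as-subΛ : ∀ {m n} (ρ : Ren m n) M → renΛ ρ M ≡ subΛ (var ∘ ρ) M
renΛ-as-subΛ ρ (var i)   = refl
renΛ-as-subΛ ρ (lam M)   = cong lam (trans (renΛ-as-subΛ (ext ρ) M)
  (subΛ-cong (λ { zero → refl ; (suc i) → refl }) M))
renΛ-as-subΛ ρ (app M N) = cong₂ app (renΛ-as-subΛ ρ M) (renΛ-as-subΛ ρ N)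

subΛ-[]Λ : ∀ {m n} (s : Fin m → Λ n) (M : Λ (suc m)) N →
           subΛ s (M [ N ]Λ) ≡ subΛ (extsΛ s) M [ subΛ s N ]Λ
subΛ-[]Λ s M N = trans (subΛ-subΛ s _ M) (trans
  (subΛ-cong (λ { zero → refl
                ; (suc i) → sym (trans (subΛ-renΛ _ suc (s i)) (subΛ-var (λ _ → refl) (s i))) }) M)
  (sym (subΛ-subΛ _ (extsΛ s) M)))

Red-subΛ : ∀ {η? m n} (s : Fin m → Λ n) {M M'} → Red η? M M' → Red η? (subΛ s M) (subΛ s M')
Red-subΛ s (β {M = M} {N})  = subst (Red _ _) (sym (subΛ-[]Λ s M N)) β
Red-subΛ s (η {M = M} p)    =
  subst (λ X → Red _ (lam (app X (var zero))) (subΛ s M)) (sym (subΛ-weaken s M)) (η p)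
Red-subΛ s (ξlam r)  = ξlam (Red-subΛ (extsΛ s) r)
Red-subΛ s (ξappₗ r) = ξappₗ (Red-subΛ s r)
Red-subΛ s (ξappᵣ r) = ξappᵣ (Red-subΛ s r)

Substitutive : LRel → Set
Substitutive R = ∀ {m n} (s : Fin m → Λ n) {M N} → R M N → R (subΛ s M) (subΛ s N)

substitutive⇒renΛ-closed : ∀ {R : LRel} → Substitutive R →
  ∀ {m n} (ρ : Ren m n) {M N} → R M N → R (renΛ ρ M) (renΛ ρ N)
substitutive⇒renΛ-closed {R} R-sub ρ {M} {N} r =
  subst₂ R (sym (renΛ-as-subΛ ρ M)) (sym (renΛ-as-subΛ ρ N)) (R-sub _ r)

record IsLambdaTheory (R : LRel) : Set where
  field
    isEquivalence : ∀ {n} → IsEquivalence (R {n})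
    lam-cong      : ∀ {n} {M M' : Λ (suc n)} → R M M' → R (lam M) (lam M')
    app-congˡ     : ∀ {n} {M M' N : Λ n} → R M M' → R (app M N) (app M' N)
    app-congʳ     : ∀ {n} {M N N' : Λ n} → R N N' → R (app M N) (app M N')
    β-conv        : ∀ {n} {M : Λ (suc n)} {N} → R (app (lam M) N) (M [ N ]Λ)
    substitutive  : Substitutive R

  module Eq {n} = IsEquivalence (isEquivalence {n})

≡Λ-substitutive : Substitutive _≡Λ_
≡Λ-substitutive s = cong (subΛ s)

conversion-isLambdaTheory : ∀ η? → IsLambdaTheory (λ {n} → EqClosure (Red η? {n}))
conversion-isLambdaTheory η? = record
  { isEquivalence = EqClosure.isEquivalence _
  ; lam-cong      = EqClosure.gmap lam ξlam
  ; app-congˡ     = EqClosure.gmap (λ M → app M _) ξappₗ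
  ; app-congʳ     = EqClosure.gmap (app _) ξappᵣ
  ; β-conv        = EqClosure.return β
  ; substitutive  = λ s → EqClosure.gmap (subΛ s) (Red-subΛ s)
  }

⟦⟧-isLambdaTheory : ∀ R → IsLambdaTheory ⟦ R ⟧
⟦⟧-isLambdaTheory βK  = conversion-isLambdaTheory false
⟦⟧-isLambdaTheory βηK = conversion-isLambdaTheory true

⌊⌋-ren : ∀ {b m n} (ρ : Ren m n) (M : Tm b m) → ⌊ ren ρ M ⌋ ≡ renΛ ρ ⌊ M ⌋
⌊⌋-ren ρ (u M)      = ⌊⌋-ren ρ M
⌊⌋-ren ρ (var i)    = refl
⌊⌋-ren ρ (lam σ M)  = cong lam (⌊⌋-ren (ext ρ) M)
⌊⌋-ren ρ (app M N)  = cong₂ app (⌊⌋-ren ρ M) (⌊⌋-ren ρ N)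
⌊⌋-ren ρ (pair M N) = ⌊⌋-ren ρ M
⌊⌋-ren ρ (pr₁ M)    = ⌊⌋-ren ρ M
⌊⌋-ren ρ (pr₂ M)    = ⌊⌋-ren ρ M
⌊⌋-ren ρ (coe M σ)  = ⌊⌋-ren ρ M

⌊⌋-sub : ∀ {b m n} (s : Fin m → Tm b n) (M : Tm b m) → ⌊ sub s M ⌋ ≡ subΛ (⌊_⌋ ∘ s) ⌊ M ⌋
⌊⌋-sub s (u M)      = ⌊⌋-sub s M
⌊⌋-sub s (var i)    = refl
⌊⌋-sub s (lam σ M)  = cong lam (trans (⌊⌋-sub (exts s) M)
  (subΛ-cong (λ { zero → refl ; (suc i) → ⌊⌋-ren suc (s i) }) ⌊ M ⌋))
⌊⌋-sub s (app M N)  = cong₂ app (⌊⌋-sub s M) (⌊⌋-sub s N)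
⌊⌋-sub s (pair M N) = ⌊⌋-sub s M
⌊⌋-sub s (pr₁ M)    = ⌊⌋-sub s M
⌊⌋-sub s (pr₂ M)    = ⌊⌋-sub s M
⌊⌋-sub s (coe M σ)  = ⌊⌋-sub s M

⌊⌋-[] : ∀ {b n} (M : Tm b (suc n)) N → ⌊ M [ N ] ⌋ ≡ ⌊ M ⌋ [ ⌊ N ⌋ ]Λ
⌊⌋-[] M N = trans (⌊⌋-sub _ M) (subΛ-cong (λ { zero → refl ; (suc i) → refl }) ⌊ M ⌋)

module Substitution (𝒯 : Theory) (R : LRel) (R-sub : Substitutive R) where

  ⊢-ren : ∀ {m n} {B : Ctx 𝒯 m} {B' : Ctx 𝒯 n} {M τ} (ρ : Ren m n) →
          (∀ i → lookup B' (ρ i) ≡ lookup B i) →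
          𝒯 ⨾ R ⨾ B ⊢ M ∶ τ → 𝒯 ⨾ R ⨾ B' ⊢ ren ρ M ∶ τ
  ⊢-ren ρ h (top p)            = top p
  ⊢-ren {B' = B'} ρ h (ax {x = x}) = subst (λ τ → 𝒯 ⨾ R ⨾ B' ⊢ var (ρ x) ∶ τ) (h x) ax
  ⊢-ren ρ h (⇒I d)             = ⇒I (⊢-ren (ext ρ) (λ { zero → refl ; (suc i) → h i }) d)
  ⊢-ren ρ h (⇒E d e)           = ⇒E (⊢-ren ρ h d) (⊢-ren ρ h e)
  ⊢-ren ρ h (∩I {M = M} {N} d e r) = ∩I (⊢-ren ρ h d) (⊢-ren ρ h e)
    (subst₂ R (sym (⌊⌋-ren ρ M)) (sym (⌊⌋-ren ρ N)) (substitutive⇒renΛ-closed R-sub ρ r))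
  ⊢-ren ρ h (∩E₁ d)            = ∩E₁ (⊢-ren ρ h d)
  ⊢-ren ρ h (∩E₂ d)            = ∩E₂ (⊢-ren ρ h d)
  ⊢-ren ρ h (≤T d le)          = ≤T (⊢-ren ρ h d) le

  ⊢-sub : ∀ {m n} {B : Ctx 𝒯 m} {B' : Ctx 𝒯 n} {M τ} {s : Fin m → Tm (hasω 𝒯) n} →
          (∀ i → 𝒯 ⨾ R ⨾ B' ⊢ s i ∶ lookup B i) →
          𝒯 ⨾ R ⨾ B ⊢ M ∶ τ → 𝒯 ⨾ R ⨾ B' ⊢ sub s M ∶ τ
  ⊢-sub h (top p)            = top p
  ⊢-sub h (ax {x = x})       = h x
  ⊢-sub h (⇒I d)             = ⇒I (⊢-sub (λ { zero → ax ; (suc i) → ⊢-ren suc (λ _ → refl) (h i) }) d)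
  ⊢-sub h (⇒E d e)           = ⇒E (⊢-sub h d) (⊢-sub h e)
  ⊢-sub {s = s} h (∩I {M = M} {N} d e r) = ∩I (⊢-sub h d) (⊢-sub h e)
    (subst₂ R (sym (⌊⌋-sub s M)) (sym (⌊⌋-sub s N)) (R-sub _ r))
  ⊢-sub h (∩E₁ d)            = ∩E₁ (⊢-sub h d)
  ⊢-sub h (∩E₂ d)            = ∩E₂ (⊢-sub h d)
  ⊢-sub h (≤T d le)          = ≤T (⊢-sub h d) le

  ⊢-[] : ∀ {n} {B : Ctx 𝒯 n} {σ τ M N} →
         𝒯 ⨾ R ⨾ (σ ∷ B) ⊢ M ∶ τ → 𝒯 ⨾ R ⨾ B ⊢ N ∶ σ → 𝒯 ⨾ R ⨾ B ⊢ M [ N ] ∶ τ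
  ⊢-[] d e = ⊢-sub (λ { zero → e ; (suc i) → ax }) d

module SynchronousSubjectReduction
  (𝒯 : Theory) (R : LRel) (R-refl : ∀ {n} {M : Λ n} → R M M) (R-sub : Substitutive R) where

  open Substitution 𝒯 R R-sub

  subject-reduction∥ : ∀ {n} {B : Ctx 𝒯 n} {Δ₁ Δ₂ σ} →
                       𝒯 ⨾ R ⨾ B ⊢ Δ₁ ∶ σ → Δ₁ ⟶∥ Δ₂ → 𝒯 ⨾ R ⨾ B ⊢ Δ₂ ∶ σ
  subject-reduction∥ (⇒E (⇒I d) e)    β             = ⊢-[] d e
  subject-reduction∥ (∩E₁ (∩I d e _)) π₁            = d
  subject-reduction∥ (∩E₂ (∩I d e _)) π₂            = e
  subject-reduction∥ (⇒I d)           (ξlam r)      = ⇒I (subject-reduction∥ d r)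
  subject-reduction∥ (⇒E d e)         (ξappₗ r)     = ⇒E (subject-reduction∥ d r) e
  subject-reduction∥ (⇒E d e)         (ξappᵣ r)     = ⇒E d (subject-reduction∥ e r)
  subject-reduction∥ (∩I d e _)       (ξpair r r' eq) =
    ∩I (subject-reduction∥ d r) (subject-reduction∥ e r') (subst (R _) eq R-refl)
  subject-reduction∥ (∩E₁ d)          (ξpr₁ r)      = ∩E₁ (subject-reduction∥ d r)
  subject-reduction∥ (∩E₂ d)          (ξpr₂ r)      = ∩E₂ (subject-reduction∥ d r)
  subject-reduction∥ (≤T d le)        (ξcoe r)      = ≤T (subject-reduction∥ d r) le

module LambdaTheorySubjectReduction (𝒯 : Theory) (R : LRel) (isλT : IsLambdaTheory R) where

  open IsLambdaTheory isλT
  open Substitution 𝒯 R substitutive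

  ⟶-⌊⌋-conv : ∀ {n} {B : Ctx 𝒯 n} {Δ₁ Δ₂ σ} →
              𝒯 ⨾ R ⨾ B ⊢ Δ₁ ∶ σ → Δ₁ ⟶ Δ₂ → R ⌊ Δ₁ ⌋ ⌊ Δ₂ ⌋
  ⟶-⌊⌋-conv _                (β {M = M} {N}) = subst (R _) (sym (⌊⌋-[] M N)) β-conv
  ⟶-⌊⌋-conv _                π₁           = Eq.refl
  ⟶-⌊⌋-conv (∩E₂ (∩I _ _ r)) π₂           = r
  ⟶-⌊⌋-conv (⇒I d)           (ξlam r)     = lam-cong (⟶-⌊⌋-conv d r)
  ⟶-⌊⌋-conv (⇒E d _)         (ξappₗ r)    = app-congˡ (⟶-⌊⌋-conv d r)
  ⟶-⌊⌋-conv (⇒E _ e)         (ξappᵣ r)    = app-congʳ (⟶-⌊⌋-conv e r)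
  ⟶-⌊⌋-conv (∩I d _ _)       (ξpairₗ r)   = ⟶-⌊⌋-conv d r
  ⟶-⌊⌋-conv _                (ξpairᵣ r)   = Eq.refl
  ⟶-⌊⌋-conv (∩E₁ d)          (ξpr₁ r)     = ⟶-⌊⌋-conv d r
  ⟶-⌊⌋-conv (∩E₂ d)          (ξpr₂ r)     = ⟶-⌊⌋-conv d r
  ⟶-⌊⌋-conv (≤T d _)         (ξcoe r)     = ⟶-⌊⌋-conv d r

  subject-reduction : ∀ {n} {B : Ctx 𝒯 n} {Δ₁ Δ₂ σ} →
                      𝒯 ⨾ R ⨾ B ⊢ Δ₁ ∶ σ → Δ₁ ⟶ Δ₂ → 𝒯 ⨾ R ⨾ B ⊢ Δ₂ ∶ σ
  subject-reduction (⇒E (⇒I d) e)    β          = ⊢-[] d e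
  subject-reduction (∩E₁ (∩I d _ _)) π₁         = d
  subject-reduction (∩E₂ (∩I _ e _)) π₂         = e
  subject-reduction (⇒I d)           (ξlam r)   = ⇒I (subject-reduction d r)
  subject-reduction (⇒E d e)         (ξappₗ r)  = ⇒E (subject-reduction d r) e
  subject-reduction (⇒E d e)         (ξappᵣ r)  = ⇒E d (subject-reduction e r)
  subject-reduction (∩I d e q)       (ξpairₗ r) =
    ∩I (subject-reduction d r) e (Eq.trans (Eq.sym (⟶-⌊⌋-conv d r)) q)
  subject-reduction (∩I d e q)       (ξpairᵣ r) =
    ∩I d (subject-reduction e r) (Eq.trans q (⟶-⌊⌋-conv e r))
  subject-reduction (∩E₁ d)          (ξpr₁ r)   = ∩E₁ (subject-reduction d r)
  subject-reduction (∩E₂ d)          (ξpr₂ r)   = ∩E₂ (subject-reduction d r)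
  subject-reduction (≤T d le)        (ξcoe r)   = ≤T (subject-reduction d r) le

theorem4p6 : (𝒯 : Theory) →
    (∀ {n} {B : Ctx 𝒯 n} {Δ₁ Δ₂ : Tm (hasω 𝒯) n} {σ : Ty 𝒯} →
       𝒯 ⨾ _≡Λ_ ⨾ B ⊢ Δ₁ ∶ σ → Δ₁ ⟶∥ Δ₂ → 𝒯 ⨾ _≡Λ_ ⨾ B ⊢ Δ₂ ∶ σ)
    × (∀ (R : BetaKind) {n} {B : Ctx 𝒯 n} {Δ₁ Δ₂ : Tm (hasω 𝒯) n} {σ : Ty 𝒯} →
       𝒯 ⨾ ⟦ R ⟧ ⨾ B ⊢ Δ₁ ∶ σ → Δ₁ ⟶ Δ₂ → 𝒯 ⨾ ⟦ R ⟧ ⨾ B ⊢ Δ₂ ∶ σ)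
theorem4p6 𝒯 =
    SynchronousSubjectReduction.subject-reduction∥ 𝒯 _≡Λ_ refl ≡Λ-substitutive
  , λ R → LambdaTheorySubjectReduction.subject-reduction 𝒯 ⟦ R ⟧ (⟦⟧-isLambdaTheory R)
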